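{- Let $\mathcal{F}$ be a family of nontrivial graphs. A graph $G$ is a convex geometry in the $\mathcal{F}$-free convexity if and only if $G$ is $\mathcal{F}$-free, i.e., $G$ has no induced subgraph isomorphic to a member of $\mathcal{F}$.
   Context: Graphs are finite and simple. For a nontrivial graph $H$ and a graph $G$, a set $S\subseteq V(G)$ is $H$-free convex if for every $S'\subseteq S$ with $|S'|=|V(H)|-1$ and every $x\in V(G)$, if the subgraph of $G$ induced by $S'\cup\{x\}$ is isomorphic to $H$, then $x\in S$. For a family $\mathcal{F}$ of nontrivial graphs, $S$ is $\mathcal{F}$-free convex if it is $H$-free convex for every $H\in\mathcal{F}$; these are the convex sets of the $\mathcal{F}$-free convexity. The convex hull $H(S)$ of $S$ is the smallest convex set containing $S$. A vertex $x$ of a convex set $S$ is an extreme vertex of $S$ if $S\setminus\{x\}$ is convex; $\mathit{ext}(S)$ denotes the set of extreme vertices of $S$. $G$ is a convex geometry (with respect to the convexity) if every convex set $S\subseteq V(G)$ satisfies $S=H(\mathit{ext}(S))$. -}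

module Defs where

open import Data.Nat using (ℕ; _∸_; _≥_)
open import Data.Fin using (Fin)
open import Data.Fin.Subset using (Subset; _∈_; _∉_; _⊆_; _∪_; ⁅_⁆; ∣_∣)
open import Data.Product using (Σ; ∃; ∃-syntax; _×_; _,_; proj₁)
open import Function.Bundles using (_⤖_; _⇔_; Bijection)
open import Relation.Binary.PropositionalEquality using (_≡_)
open import Relation.Nullary using (¬_)

record Graph : Set₁ where
  field
    size : ℕ
    Adj  : Fin size → Fin size → Set
    sym  : ∀ {u v} → Adj u v → Adj v u
    irr  : ∀ {u} → ¬ Adj u u

open Graph public

Nontrivial : Graph → Set
Nontrivial H = size H ≥ 2

Vert : (G : Graph) → Subset (size G) → Set
Vert G T = Σ (Fin (size G)) (λ v → v ∈ T)

IsoInduced : (H G : Graph) → Subset (size G) → Set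
IsoInduced H G T =
  Σ (Fin (size H) ⤖ Vert G T) λ f →
    ∀ u v → Adj H u v ⇔ Adj G (proj₁ (Bijection.to f u)) (proj₁ (Bijection.to f v))

HConvex : (H G : Graph) → Subset (size G) → Set
HConvex H G S =
  ∀ (S' : Subset (size G)) → S' ⊆ S → ∣ S' ∣ ≡ size H ∸ 1 →
  ∀ (x : Fin (size G)) → IsoInduced H G (S' ∪ ⁅ x ⁆) → x ∈ S

FConvex : {I : Set} → (I → Graph) → (G : Graph) → Subset (size G) → Set
FConvex F G S = ∀ i → HConvex (F i) G S

IsExtreme : {I : Set} → (I → Graph) → (G : Graph) → Subset (size G) → Fin (size G) → Set
IsExtreme F G S x = x ∈ S × (∀ S⁻ → (∀ y → y ∈ S⁻ → (y ∈ S × ¬ y ≡ x))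
                                   → (∀ y → y ∈ S → ¬ y ≡ x → y ∈ S⁻)
                                   → FConvex F G S⁻)

-- S equals the convex hull of ext(S): S contains ext(S) (trivially), is convex,
-- and is contained in every convex set containing ext(S).
EqualsHullOfExt : {I : Set} → (I → Graph) → (G : Graph) → Subset (size G) → Set
EqualsHullOfExt F G S =
  FConvex F G S × (∀ x → IsExtreme F G S x → x ∈ S) ×
  (∀ C → FConvex F G C → (∀ x → IsExtreme F G S x → x ∈ C) → S ⊆ C)

ConvexGeometry : {I : Set} → (I → Graph) → Graph → Set
ConvexGeometry F G = ∀ S → FConvex F G S → EqualsHullOfExt F G S

FFree : {I : Set} → (I → Graph) → Graph → Set
FFree F G = ¬ (∃[ i ] ∃[ T ] IsoInduced (F i) G T)

-- A vertex y lying in an induced copy T of some H ∈ F is never extreme in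
-- V(G): removing y leaves T - y, which together with y induces H, so y is
-- back in the hull. Conversely, when all members of F are nontrivial, a set
-- meeting no such copy is convex, because every candidate S' is nonempty.
-- Hence ext(V(G)) is convex, and if G is a convex geometry it must be all of
-- V(G); so G has no copy at all. If G is F-free, every set is convex, every
-- vertex of a set is extreme, and each set is trivially the hull of itself.
-- Extremeness is not decidable, but it only needs to be decided on the
-- finitely many vertices of G, which is possible under a double negation.
module Submission where

open import Defs hiding (sym)
open import Data.Fin as Fin using (Fin; zero; suc)
open import Data.Fin.Permutation using (↔⇒≡)
open import Data.Fin.Subset
  using (Subset; Nonempty; inside; outside; _∈_; _∉_; _⊆_; _∪_; _-_; ⁅_⁆; ∣_∣; ⊤)
open import Data.Fin.Subset.Properties
  using (∈⊤; p─⊥≡p; p─q⊆p; ∪-identityʳ; x∈p∪q⁺; x∈p∧x≢y⇒x∈p-y)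
open import Data.Nat as ℕ using (ℕ; _<_; _∸_; s≤s; z≤n)
open import Data.Nat.Properties using (≤-trans; m<n⇒0<n∸m)
open import Data.Product as Product using (∃; _×_; _,_; proj₁; proj₂)
open import Data.Sum using (inj₁)
open import Data.Vec using (_∷_; tabulate; here; there)
open import Data.Vec.Properties using ([]=⇒lookup; lookup⇒[]=; lookup∘tabulate)
open import Function using (_∘_)
open import Function.Bundles using (_⇔_; _↔_; _⤖_; mk⇔; mk↔ₛ′; Bijection)
open import Function.Construct.Composition using (_↔-∘_)
open import Function.Construct.Symmetry using (↔-sym)
open import Function.Properties.Bijection using (⤖⇒↔)
open import Level using (Level)
open import Relation.Binary.PropositionalEquality using (_≡_; _≢_; refl; sym; trans; cong; subst)
open import Relation.Nullary using (¬_; Dec; yes; no; does; contradiction)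
open import Relation.Nullary.Decidable using (dec-true)
open import Relation.Unary using (Pred; Decidable)

private
  variable
    ℓ : Level
    k n : ℕ
    p : Subset n
    x y : Fin n

private
  enumerate : (p : Subset n) → Fin ∣ p ∣ → ∃ (_∈ p)
  enumerate (inside ∷ p) zero = zero , here
  enumerate (inside ∷ p) (suc j) = Product.map suc there (enumerate p j)
  enumerate (outside ∷ p) j = Product.map suc there (enumerate p j)

  rank : (p : Subset n) → ∃ (_∈ p) → Fin ∣ p ∣
  rank (inside ∷ p) (zero , here) = zero
  rank (inside ∷ p) (suc x , there x∈p) = suc (rank p (x , x∈p))
  rank (outside ∷ p) (suc x , there x∈p) = rank p (x , x∈p)

  rank-enumerate : (p : Subset n) (j : Fin ∣ p ∣) → rank p (enumerate p j) ≡ j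
  rank-enumerate (inside ∷ p) zero = refl
  rank-enumerate (inside ∷ p) (suc j) = cong suc (rank-enumerate p j)
  rank-enumerate (outside ∷ p) j = rank-enumerate p j

  enumerate-rank : (p : Subset n) (m : ∃ (_∈ p)) → enumerate p (rank p m) ≡ m
  enumerate-rank (inside ∷ p) (zero , here) = refl
  enumerate-rank (inside ∷ p) (suc x , there x∈p) =
    cong (Product.map suc there) (enumerate-rank p (x , x∈p))
  enumerate-rank (outside ∷ p) (suc x , there x∈p) =
    cong (Product.map suc there) (enumerate-rank p (x , x∈p))

Fin∣p∣↔∈p : (p : Subset n) → Fin ∣ p ∣ ↔ ∃ (_∈ p)
Fin∣p∣↔∈p p = mk↔ₛ′ (enumerate p) (rank p) (enumerate-rank p) (rank-enumerate p)

⤖⇒∣p∣≡ : Fin k ⤖ ∃ (_∈ p) → ∣ p ∣ ≡ k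
⤖⇒∣p∣≡ {p = p} f = ↔⇒≡ (↔-sym (⤖⇒↔ f) ↔-∘ Fin∣p∣↔∈p p)

0<∣p∣⇒Nonempty : (p : Subset n) → 0 < ∣ p ∣ → Nonempty p
0<∣p∣⇒Nonempty (inside ∷ p) _ = zero , here
0<∣p∣⇒Nonempty (outside ∷ p) 0<∣p∣ = Product.map suc there (0<∣p∣⇒Nonempty p 0<∣p∣)

x∉p-x : x ∉ p - x
x∉p-x {x = suc x} {p = _ ∷ p} (there x∈p-x) = x∉p-x x∈p-x

x∈p-y⇒x≢y : x ∈ p - y → x ≢ y
x∈p-y⇒x≢y x∈p-x refl = x∉p-x x∈p-x

x∈p-y⇒x∈p : x ∈ p - y → x ∈ p
x∈p-y⇒x∈p = p─q⊆p _ _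

x∈p⇒suc∣p-x∣≡∣p∣ : x ∈ p → ℕ.suc ∣ p - x ∣ ≡ ∣ p ∣
x∈p⇒suc∣p-x∣≡∣p∣ {p = inside ∷ p} here = cong (ℕ.suc ∘ ∣_∣) (p─⊥≡p p)
x∈p⇒suc∣p-x∣≡∣p∣ {p = inside ∷ p} (there x∈p) = cong ℕ.suc (x∈p⇒suc∣p-x∣≡∣p∣ x∈p)
x∈p⇒suc∣p-x∣≡∣p∣ {p = outside ∷ p} (there x∈p) = x∈p⇒suc∣p-x∣≡∣p∣ x∈p

x∈p⇒p-x∪⁅x⁆≡p : x ∈ p → (p - x) ∪ ⁅ x ⁆ ≡ p
x∈p⇒p-x∪⁅x⁆≡p {p = inside ∷ p} here =
  cong (inside ∷_) (trans (∪-identityʳ _) (p─⊥≡p p))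
x∈p⇒p-x∪⁅x⁆≡p {p = inside ∷ p} (there x∈p) = cong (inside ∷_) (x∈p⇒p-x∪⁅x⁆≡p x∈p)
x∈p⇒p-x∪⁅x⁆≡p {p = outside ∷ p} (there x∈p) = cong (outside ∷_) (x∈p⇒p-x∪⁅x⁆≡p x∈p)

satisfying : {P : Pred (Fin n) ℓ} → Decidable P → Subset n
satisfying P? = tabulate (does ∘ P?)

module _ {P : Pred (Fin n) ℓ} (P? : Decidable P) where

  ∈satisfying⁺ : P x → x ∈ satisfying P?
  ∈satisfying⁺ {x = x} Px =
    lookup⇒[]= x _ (trans (lookup∘tabulate _ x) (dec-true (P? x) Px))

  ∈satisfying⁻ : x ∈ satisfying P? → P x
  ∈satisfying⁻ {x = x} x∈
    with P? x | trans (sym (lookup∘tabulate (does ∘ P?) x)) ([]=⇒lookup x∈)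
  ... | yes Px | _ = Px
  ... | no _ | ()

¬¬-decidable : (P : Pred (Fin n) ℓ) → ¬ ¬ Decidable P
¬¬-decidable {n = ℕ.zero} P ¬dec = ¬dec λ ()
¬¬-decidable {n = ℕ.suc n} P ¬dec = ¬¬-decidable (P ∘ suc) λ P∘suc? →
  let ¬dec₀ : ¬ Dec (P zero)
      ¬dec₀ P₀? = ¬dec λ { zero → P₀? ; (suc x) → P∘suc? x }
  in ¬dec₀ (no (¬dec₀ ∘ yes))

module _ {I : Set} (F : I → Graph) (G : Graph) where

  InCopy : Fin (size G) → Set
  InCopy y = ∃ λ i → ∃ λ T → IsoInduced (F i) G T × y ∈ T

  extreme⇒¬InCopy : IsExtreme F G ⊤ y → ¬ InCopy y
  extreme⇒¬InCopy {y = y} (_ , removable) (i , T , copy , y∈T) =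
    x∈p-y⇒x≢y y∈⊤-y refl
    where
    ⊤-y-convex : FConvex F G (⊤ - y)
    ⊤-y-convex = removable (⊤ - y)
      (λ _ z∈ → x∈p-y⇒x∈p z∈ , x∈p-y⇒x≢y z∈)
      (λ _ z∈ z≢y → x∈p∧x≢y⇒x∈p-y z∈ z≢y)

    T-y⊆⊤-y : T - y ⊆ ⊤ - y
    T-y⊆⊤-y z∈ = x∈p∧x≢y⇒x∈p-y ∈⊤ (x∈p-y⇒x≢y z∈)

    ∣T-y∣ : ∣ T - y ∣ ≡ size (F i) ∸ 1
    ∣T-y∣ = cong (_∸ 1) (trans (x∈p⇒suc∣p-x∣≡∣p∣ y∈T) (⤖⇒∣p∣≡ (proj₁ copy)))

    y∈⊤-y : y ∈ ⊤ - y
    y∈⊤-y = ⊤-y-convex i (T - y) T-y⊆⊤-y ∣T-y∣ y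
      (subst (IsoInduced (F i) G) (sym (x∈p⇒p-x∪⁅x⁆≡p y∈T)) copy)

  copyFree⇒convex : (∀ i → Nontrivial (F i)) → {C : Subset (size G)} →
                    (∀ {y} → y ∈ C → ¬ InCopy y) → FConvex F G C
  copyFree⇒convex nontrivial C-copyFree i S' S'⊆C ∣S'∣ x copy
    with y , y∈S' ← 0<∣p∣⇒Nonempty S' (subst (0 <_) (sym ∣S'∣) (m<n⇒0<n∸m (nontrivial i))) =
    contradiction (i , _ , copy , x∈p∪q⁺ (inj₁ y∈S')) (C-copyFree (S'⊆C y∈S'))

  ⊤-convex : FConvex F G ⊤
  ⊤-convex _ _ _ _ _ _ = ∈⊤

  FFree⇒convex : FFree F G → (S : Subset (size G)) → FConvex F G S
  FFree⇒convex free S i S' _ _ x copy = contradiction (i , _ , copy) free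

  FFree⇒ConvexGeometry : FFree F G → ConvexGeometry F G
  FFree⇒ConvexGeometry free S _ =
    FFree⇒convex free S , (λ _ → proj₁) ,
    λ C _ ext⊆C x∈S → ext⊆C _ (x∈S , λ S⁻ _ _ → FFree⇒convex free S⁻)

  decidable-extreme⇒all-extreme : (∀ i → Nontrivial (F i)) → ConvexGeometry F G →
                                  Decidable (IsExtreme F G ⊤) → ∀ y → IsExtreme F G ⊤ y
  decidable-extreme⇒all-extreme nontrivial geometry extreme? y =
    ∈satisfying⁻ extreme? (⊤⊆extremes ∈⊤)
    where
    extremes-convex : FConvex F G (satisfying extreme?)
    extremes-convex = copyFree⇒convex nontrivial (extreme⇒¬InCopy ∘ ∈satisfying⁻ extreme?)

    ⊤⊆extremes : ⊤ ⊆ satisfying extreme?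
    ⊤⊆extremes = proj₂ (proj₂ (geometry ⊤ ⊤-convex)) _ extremes-convex
      (λ _ → ∈satisfying⁺ extreme?)

  ConvexGeometry⇒FFree : (∀ i → Nontrivial (F i)) → ConvexGeometry F G → FFree F G
  ConvexGeometry⇒FFree nontrivial geometry (i , T , copy) =
    ¬¬-decidable (IsExtreme F G ⊤) λ extreme? →
      extreme⇒¬InCopy
        (decidable-extreme⇒all-extreme nontrivial geometry extreme? (proj₁ vertex))
        (i , T , copy , proj₂ vertex)
    where
    vertex : ∃ (_∈ T)
    vertex = Bijection.to (proj₁ copy) (Fin.fromℕ< (≤-trans (s≤s z≤n) (nontrivial i)))

mainTheorem3 : {I : Set} (F : I → Graph) → (∀ i → Nontrivial (F i)) →
    (G : Graph) → ConvexGeometry F G ⇔ FFree F G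
mainTheorem3 F nontrivial G =
  mk⇔ (ConvexGeometry⇒FFree F G nontrivial) (FFree⇒ConvexGeometry F G)
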